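{- Let $G$ be a uniquely half-covered graph. Then (i) $G$ is not bipartite, and (ii) there exists a half-integral perfect fractional matching in $G$.
   Context: For a graph $G=(V,E)$, a fractional matching is a function $m:E\to[0,1]$ with $\sum_{w\in N_G(v)}m(vw)\le 1$ for every $v\in V$; it is perfect if its total weight $\sum_{e\in E}m(e)$ equals $|V|/2$. A fractional vertex cover is a function $f:V\to[0,1]$ with $f(v)+f(w)\ge 1$ for every edge $vw\in E$; its total weight is $\sum_{v\in V}f(v)$. A function (fractional matching or fractional vertex cover) is half-integral if its values lie in $\{0,\frac12,1\}$. A graph $G$ is uniquely half-covered if the only half-integral fractional vertex cover of $G$ of total weight at most $|V(G)|/2$ is the constant-$\frac12$ function. -}

module Defs where

open import Data.Nat as ℕ using (ℕ)
open import Data.Bool using (Bool; true; false; if_then_else_; T)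
open import Data.Fin using (Fin; toℕ)
open import Data.Integer using (+_)
open import Data.Rational using (ℚ; 0ℚ; 1ℚ; ½; _+_; _≤_; _/_)
open import Data.Vec.Functional using (foldr)
open import Data.Product using (_×_; ∃)
open import Data.Sum using (_⊎_)
open import Relation.Binary.PropositionalEquality using (_≡_; _≢_)

record Graph : Set where
  field
    n     : ℕ
    adj   : Fin n → Fin n → Bool
    sym   : ∀ v w → adj v w ≡ adj w v
    irrefl : ∀ v → adj v v ≡ false
open Graph public

Edge : (G : Graph) → Fin (n G) → Fin (n G) → Set
Edge G v w = T (adj G v w)

Σ : ∀ {k} → (Fin k → ℚ) → ℚ
Σ f = foldr _+_ 0ℚ f

halfOrder : Graph → ℚ
halfOrder G = (+ n G) / 2

IsFractionalVertexCover : (G : Graph) → (Fin (n G) → ℚ) → Set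
IsFractionalVertexCover G f =
  (∀ v → 0ℚ ≤ f v × f v ≤ 1ℚ) ×
  (∀ v w → Edge G v w → 1ℚ ≤ f v + f w)

coverWeight : (G : Graph) → (Fin (n G) → ℚ) → ℚ
coverWeight G f = Σ f

HalfValue : ℚ → Set
HalfValue q = q ≡ 0ℚ ⊎ q ≡ ½ ⊎ q ≡ 1ℚ

HalfIntegralCover : (G : Graph) → (Fin (n G) → ℚ) → Set
HalfIntegralCover G f = ∀ v → HalfValue (f v)

UniquelyHalfCovered : Graph → Set
UniquelyHalfCovered G =
  ∀ (f : Fin (n G) → ℚ) →
    IsFractionalVertexCover G f → HalfIntegralCover G f →
    coverWeight G f ≤ halfOrder G → ∀ v → f v ≡ ½

IsBipartite : Graph → Set
IsBipartite G = ∃ λ (c : Fin (n G) → Bool) → ∀ v w → Edge G v w → c v ≢ c w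

-- Fractional matchings.  A function on edges m : E → [0,1] is represented
-- as a symmetric function on ordered vertex pairs; only its values on
-- edges matter.

load : (G : Graph) → (Fin (n G) → Fin (n G) → ℚ) → Fin (n G) → ℚ
load G m v = Σ (λ w → if adj G v w then m v w else 0ℚ)

matchingWeight : (G : Graph) → (Fin (n G) → Fin (n G) → ℚ) → ℚ
matchingWeight G m =
  Σ (λ v → Σ (λ w → if adj G v w then (if toℕ v ℕ.<ᵇ toℕ w then m v w else 0ℚ) else 0ℚ))

IsFractionalMatching : (G : Graph) → (Fin (n G) → Fin (n G) → ℚ) → Set
IsFractionalMatching G m =
  (∀ v w → m v w ≡ m w v) ×
  (∀ v w → Edge G v w → 0ℚ ≤ m v w × m v w ≤ 1ℚ) ×
  (∀ v → load G m v ≤ 1ℚ)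

IsPerfect : (G : Graph) → (Fin (n G) → Fin (n G) → ℚ) → Set
IsPerfect G m = matchingWeight G m ≡ halfOrder G

HalfIntegralMatching : (G : Graph) → (Fin (n G) → Fin (n G) → ℚ) → Set
HalfIntegralMatching G m = ∀ v w → Edge G v w → HalfValue (m v w)

{-# OPTIONS --safe #-}
-- A vertex cover (A, B) of the bipartite double cover of G, that is, v ∈ A or
-- w ∈ B for every edge vw, gives the half-integral fractional vertex cover
-- v ↦ ([v ∈ A] + [v ∈ B]) / 2 of weight (|A| + |B|) / 2.  When G is uniquely
-- half-covered, every such cover with |A| + |B| ≤ |V| must therefore put each
-- vertex in exactly one of A and B.  For A = B a colour class of size at most
-- |V| / 2 this is impossible, so G is not bipartite.  For A = V ∖ X and B = N(X)
-- it gives |N(X)| ≥ |X| for every X ⊆ V, so by Hall's theorem there is an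
-- injection σ with vσ(v) ∈ E for all v, and m(vw) = ([σ v = w] + [σ w = v]) / 2
-- is a half-integral perfect fractional matching.
module Submission where

open import Defs
open import Data.Nat using (NonZero)
open import Data.Product using (_×_; ∃)
open import Data.Rational using (ℚ)
open import Data.Fin using (Fin)
open import Relation.Nullary using (¬_)

open import Data.Bool using (Bool; true; false; not; if_then_else_; T)
open import Data.Bool.Properties using (T-≡; ¬-not; not-injective; if-float; if-cong-then)
open import Data.Fin using (zero; suc; toℕ; fromℕ<)
import Data.Fin.Properties as Fin
open import Data.Fin.Subset
open import Data.Fin.Subset.Properties
import Data.Integer as ℤ
import Data.Integer.Properties as ℤ
open import Data.Integer.Tactic.RingSolver as ℤ-Solver using ()
open import Data.Nat as ℕ using (ℕ; zero; suc; _+_; _*_; _≤_; _<_; z≤n; s≤s)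
open import Data.Nat.Induction using (<-wellFounded)
import Data.Nat.Properties as ℕ
open import Data.Nat.Tactic.RingSolver as ℕ-Solver using ()
open import Data.Product using (_,_; proj₁; proj₂)
open import Data.Rational as ℚ using (0ℚ; 1ℚ; ½; toℚᵘ)
import Data.Rational.Properties as ℚ
import Data.Rational.Unnormalised as ℚᵘ
import Data.Rational.Unnormalised.Properties as ℚᵘ
open import Data.Sum using (_⊎_; inj₁; inj₂; [_,_]′)
open import Data.Vec using ([]; _∷_; here; there; tabulate)
open import Data.Vec.Properties using (lookup∘tabulate; lookup⇒[]=; []=⇒lookup; tabulate-∘)
open import Function using (_∘_; Equivalence)
open import Induction.WellFounded using (Acc; acc)
open import Relation.Binary.PropositionalEquality as ≡
  using (_≡_; _≢_; refl; trans; cong; cong₂; subst; ≢-sym)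
open import Relation.Nullary using (Dec; yes; no; does; contradiction)
open import Relation.Nullary.Decidable using (_×-dec_)
open import Relation.Nullary.Reflects using (ofʸ; ofⁿ)

open import Algebra.Properties.CommutativeMonoid.Sum ℕ.+-0-commutativeMonoid
  using (sum; ∑-distrib-+; ∑-comm; sum-cong-≗; sum-replicate-zero)
open import Algebra.Properties.CommutativeMonoid.Sum ℚ.+-0-commutativeMonoid
  using () renaming (sum-cong-≗ to Σ-cong)

variable
  a b k m : ℕ

χ : Subset m → Fin m → ℕ
χ p i = if does (i ∈? p) then 1 else 0

χ-∈ : ∀ {p : Subset m} {i} → i ∈ p → χ p i ≡ 1
χ-∈ {p = p} {i} i∈p with i ∈? p
... | yes _ = refl
... | no i∉p = contradiction i∈p i∉p

χ-∉ : ∀ {p : Subset m} {i} → i ∉ p → χ p i ≡ 0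
χ-∉ {p = p} {i} i∉p with i ∈? p
... | yes i∈p = contradiction i∈p i∉p
... | no _ = refl

χ≤1 : ∀ (p : Subset m) i → χ p i ≤ 1
χ≤1 p i with i ∈? p
... | yes _ = s≤s z≤n
... | no _ = z≤n

0<χ⇒∈ : ∀ {p : Subset m} {i} → 0 < χ p i → i ∈ p
0<χ⇒∈ {p = p} {i} 0<χ with i ∈? p
... | yes i∈p = i∈p

sum-χ : ∀ (p : Subset m) → sum (χ p) ≡ ∣ p ∣
sum-χ [] = refl
sum-χ (inside ∷ p) = cong suc (sum-χ p)
sum-χ (outside ∷ p) = sum-χ p

1≤χ+χ : ∀ {p q : Subset m} {i j} → i ∈ p ⊎ j ∈ q → 1 ≤ χ p i + χ q j
1≤χ+χ {q = q} {j = j} (inj₁ i∈p) = subst (λ x → 1 ≤ x + χ q j) (≡.sym (χ-∈ i∈p)) (s≤s z≤n)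
1≤χ+χ {p = p} {i = i} (inj₂ j∈q) = subst (λ x → 1 ≤ χ p i + x) (≡.sym (χ-∈ j∈q)) (ℕ.m≤n+m 1 (χ p i))

sum-const-1 : ∀ m → sum {m} (λ _ → 1) ≡ m
sum-const-1 zero = refl
sum-const-1 (suc m) = cong suc (sum-const-1 m)

sum-0 : ∀ {f : Fin m → ℕ} → (∀ i → f i ≡ 0) → sum f ≡ 0
sum-0 {m} f≡0 = trans (sum-cong-≗ f≡0) (sum-replicate-zero m)

sum≤1 : ∀ (f : Fin m → ℕ) → (∀ i → f i ≤ 1) →
        (∀ i j → 0 < f i → 0 < f j → i ≡ j) → sum f ≤ 1
sum≤1 {zero} f f≤1 unique = z≤n
sum≤1 {suc m} f f≤1 unique with f zero in eq
... | zero = sum≤1 (f ∘ suc) (f≤1 ∘ suc) λ i j p q → Fin.suc-injective (unique (suc i) (suc j) p q)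
... | suc j = begin
  suc j + sum (f ∘ suc) ≡⟨ cong (suc j +_) (sum-0 tail≡0) ⟩
  suc j + 0             ≡⟨ ℕ.+-identityʳ (suc j) ⟩
  suc j                 ≡⟨ eq ⟨
  f zero                ≤⟨ f≤1 zero ⟩
  1                     ∎
  where
  open ℕ.≤-Reasoning
  tail≡0 : ∀ i → f (suc i) ≡ 0
  tail≡0 i = ℕ.n≤0⇒n≡0 (ℕ.≮⇒≥ λ 0<f →
    contradiction (unique zero (suc i) (subst (0 <_) (≡.sym eq) (s≤s z≤n)) 0<f) λ ())

∣p∪q∣≡∣p─q∣+∣q∣ : ∀ (p q : Subset m) → ∣ p ∪ q ∣ ≡ ∣ p ─ q ∣ + ∣ q ∣
∣p∪q∣≡∣p─q∣+∣q∣ [] [] = refl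
∣p∪q∣≡∣p─q∣+∣q∣ (inside ∷ p) (inside ∷ q) =
  trans (cong suc (∣p∪q∣≡∣p─q∣+∣q∣ p q)) (≡.sym (ℕ.+-suc _ _))
∣p∪q∣≡∣p─q∣+∣q∣ (outside ∷ p) (inside ∷ q) =
  trans (cong suc (∣p∪q∣≡∣p─q∣+∣q∣ p q)) (≡.sym (ℕ.+-suc _ _))
∣p∪q∣≡∣p─q∣+∣q∣ (inside ∷ p) (outside ∷ q) = cong suc (∣p∪q∣≡∣p─q∣+∣q∣ p q)
∣p∪q∣≡∣p─q∣+∣q∣ (outside ∷ p) (outside ∷ q) = ∣p∪q∣≡∣p─q∣+∣q∣ p q

∣p∣+∣∁p∣≡n : ∀ (p : Subset m) → ∣ p ∣ + ∣ ∁ p ∣ ≡ m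
∣p∣+∣∁p∣≡n p = trans (cong (∣ p ∣ +_) (∣∁p∣≡n∸∣p∣ p)) (ℕ.m+[n∸m]≡n (∣p∣≤n p))

x∈p─q⇒x∉q : ∀ {x} {p q : Subset m} → x ∈ p ─ q → x ∉ q
x∈p─q⇒x∉q {p = _ ∷ p} {outside ∷ q} here ()
x∈p─q⇒x∉q {p = _ ∷ p} {_ ∷ q} (there x∈p─q) (there x∈q) = x∈p─q⇒x∉q x∈p─q x∈q

Empty⇒∣p∣≡0 : ∀ {p : Subset m} → Empty p → ∣ p ∣ ≡ 0
Empty⇒∣p∣≡0 {m} p≡∅ = trans (cong ∣_∣ (Empty-unique p≡∅)) (∣⊥∣≡0 m)

0<∣p∣⇒Nonempty : ∀ {p : Subset m} → 0 < ∣ p ∣ → Nonempty p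
0<∣p∣⇒Nonempty {p = p} 0<∣p∣ with nonempty? p
... | yes p≢∅ = p≢∅
... | no p≡∅ = contradiction (Empty⇒∣p∣≡0 p≡∅) (ℕ.>⇒≢ 0<∣p∣)

∈-tabulate⁺ : ∀ {f : Fin m → Bool} {i} → f i ≡ true → i ∈ tabulate f
∈-tabulate⁺ {f = f} {i} fi≡true = lookup⇒[]= i (tabulate f) (trans (lookup∘tabulate f i) fi≡true)

∈-tabulate⁻ : ∀ {f : Fin m → Bool} {i} → i ∈ tabulate f → f i ≡ true
∈-tabulate⁻ {f = f} {i} i∈ = trans (≡.sym (lookup∘tabulate f i)) ([]=⇒lookup i∈)

image : (Fin a → Subset b) → Subset a → Subset b
image R [] = ⊥
image R (inside ∷ X) = R zero ∪ image (R ∘ suc) X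
image R (outside ∷ X) = image (R ∘ suc) X

∈-image⁺ : ∀ {R : Fin a → Subset b} {X x y} → x ∈ X → y ∈ R x → y ∈ image R X
∈-image⁺ {X = inside ∷ X} here y∈Rx = x∈p∪q⁺ (inj₁ y∈Rx)
∈-image⁺ {X = inside ∷ X} (there x∈X) y∈Rx = x∈p∪q⁺ (inj₂ (∈-image⁺ x∈X y∈Rx))
∈-image⁺ {X = outside ∷ X} (there x∈X) y∈Rx = ∈-image⁺ x∈X y∈Rx

∈-image⁻ : ∀ (R : Fin a → Subset b) X {y} → y ∈ image R X → ∃ λ x → x ∈ X × y ∈ R x
∈-image⁻ R [] y∈ = contradiction y∈ ∉⊥
∈-image⁻ R (inside ∷ X) y∈ with x∈p∪q⁻ (R zero) (image (R ∘ suc) X) y∈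
... | inj₁ y∈R0 = zero , here , y∈R0
... | inj₂ y∈ᵢ with ∈-image⁻ (R ∘ suc) X y∈ᵢ
...   | x , x∈X , y∈Rx = suc x , there x∈X , y∈Rx
∈-image⁻ R (outside ∷ X) y∈ with ∈-image⁻ (R ∘ suc) X y∈
... | x , x∈X , y∈Rx = suc x , there x∈X , y∈Rx

image-∪ : ∀ (R : Fin a → Subset b) X Y → image R (X ∪ Y) ⊆ image R X ∪ image R Y
image-∪ R X Y y∈ with ∈-image⁻ R (X ∪ Y) y∈
... | x , x∈X∪Y , y∈Rx with x∈p∪q⁻ X Y x∈X∪Y
...   | inj₁ x∈X = x∈p∪q⁺ (inj₁ (∈-image⁺ x∈X y∈Rx))
...   | inj₂ x∈Y = x∈p∪q⁺ (inj₂ (∈-image⁺ x∈Y y∈Rx))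

image-─ : ∀ (R : Fin a → Subset b) X S → image R X ─ S ⊆ image (λ x → R x ─ S) X
image-─ R X S {y} y∈ with ∈-image⁻ R X (p─q⊆p (image R X) S y∈)
... | x , x∈X , y∈Rx = ∈-image⁺ x∈X (x∈p∧x∉q⇒x∈p─q y∈Rx (x∈p─q⇒x∉q y∈))

HallCondition : (Fin a → Subset b) → Subset a → Set
HallCondition R L = ∀ X → X ⊆ L → ∣ X ∣ ≤ ∣ image R X ∣

record Matching (R : Fin a → Subset b) (L : Subset a) : Set where
  field
    partner           : ∀ {x} → x ∈ L → Fin b
    partner-∈         : ∀ {x} (x∈L : x ∈ L) → partner x∈L ∈ R x
    partner-injective : ∀ {x y} (x∈L : x ∈ L) (y∈L : y ∈ L) →
                        partner x∈L ≡ partner y∈L → x ≡ y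
open Matching

Empty⇒Matching : ∀ {R : Fin a → Subset b} {L} → Empty L → Matching R L
Empty⇒Matching L≡∅ = record
  { partner = λ x∈L → contradiction (_ , x∈L) L≡∅
  ; partner-∈ = λ x∈L → contradiction (_ , x∈L) L≡∅
  ; partner-injective = λ x∈L _ _ → contradiction (_ , x∈L) L≡∅
  }

singletonMatching : ∀ {R : Fin a → Subset b} {x y} → y ∈ R x → Matching R ⁅ x ⁆
singletonMatching {R = R} {x} {y} y∈Rx = record
  { partner = λ _ → y
  ; partner-∈ = λ x′∈⁅x⁆ → subst (λ x′ → y ∈ R x′) (≡.sym (x∈⁅y⁆⇒x≡y x x′∈⁅x⁆)) y∈Rx
  ; partner-injective = λ x₁∈ x₂∈ _ → trans (x∈⁅y⁆⇒x≡y x x₁∈) (≡.sym (x∈⁅y⁆⇒x≡y x x₂∈))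
  }

module _ {R : Fin a → Subset b} {L X : Subset a} (S : Subset b)
         (M₁ : Matching R X) (M₁⊆S : ∀ {x} (x∈X : x ∈ X) → partner M₁ x∈X ∈ S)
         (M₂ : Matching (λ x → R x ─ S) (L ─ X)) where

  private
    split : ∀ {x} → x ∈ L → x ∈ X ⊎ x ∈ L ─ X
    split {x} x∈L with x ∈? X
    ... | yes x∈X = inj₁ x∈X
    ... | no x∉X = inj₂ (x∈p∧x∉q⇒x∈p─q x∈L x∉X)

    partner′ : ∀ {x} → x ∈ X ⊎ x ∈ L ─ X → Fin b
    partner′ (inj₁ x∈X) = partner M₁ x∈X
    partner′ (inj₂ x∈L─X) = partner M₂ x∈L─X

    partner′-∈ : ∀ {x} (x∈ : x ∈ X ⊎ x ∈ L ─ X) → partner′ x∈ ∈ R x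
    partner′-∈ (inj₁ x∈X) = partner-∈ M₁ x∈X
    partner′-∈ (inj₂ x∈L─X) = p─q⊆p _ S (partner-∈ M₂ x∈L─X)

    separated : ∀ {x y} (x∈X : x ∈ X) (y∈L─X : y ∈ L ─ X) → partner M₁ x∈X ≢ partner M₂ y∈L─X
    separated x∈X y∈L─X eq =
      x∈p─q⇒x∉q (partner-∈ M₂ y∈L─X) (subst (_∈ S) eq (M₁⊆S x∈X))

    partner′-injective : ∀ {x y} (x∈ : x ∈ X ⊎ x ∈ L ─ X) (y∈ : y ∈ X ⊎ y ∈ L ─ X) →
                         partner′ x∈ ≡ partner′ y∈ → x ≡ y
    partner′-injective (inj₁ x∈X) (inj₁ y∈X) = partner-injective M₁ x∈X y∈X
    partner′-injective (inj₂ x∈L─X) (inj₂ y∈L─X) = partner-injective M₂ x∈L─X y∈L─X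
    partner′-injective (inj₁ x∈X) (inj₂ y∈L─X) eq = contradiction eq (separated x∈X y∈L─X)
    partner′-injective (inj₂ x∈L─X) (inj₁ y∈X) eq = contradiction (≡.sym eq) (separated y∈X x∈L─X)

  combineMatchings : Matching R L
  combineMatchings = record
    { partner = partner′ ∘ split
    ; partner-∈ = partner′-∈ ∘ split
    ; partner-injective = λ x∈L y∈L → partner′-injective (split x∈L) (split y∈L)
    }

Tight : (Fin a → Subset b) → Subset a → Subset a → Set
Tight R L X = Nonempty X × X ⊂ L × ∣ image R X ∣ ≤ ∣ X ∣

tight? : ∀ (R : Fin a → Subset b) L X → Dec (Tight R L X)
tight? R L X = nonempty? X ×-dec X ⊂? L ×-dec ∣ image R X ∣ ℕ.≤? ∣ X ∣

HallBelow : ℕ → ℕ → ℕ → Set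
HallBelow a b k = ∀ {R : Fin a → Subset b} {L} → ∣ L ∣ < k → HallCondition R L → Matching R L

hall-tight : ∀ {a b} {R : Fin a → Subset b} {L X} → HallBelow a b ∣ L ∣ →
             HallCondition R L → Tight R L X → Matching R L
hall-tight {b = b} {R = R} {L} {X} ih cond ((x , x∈X) , X⊂L , ∣NX∣≤∣X∣) =
  combineMatchings N M₁ (λ x∈X → ∈-image⁺ x∈X (partner-∈ M₁ x∈X)) M₂
  where
  N : Subset b
  N = image R X

  X⊆L : X ⊆ L
  X⊆L = proj₁ X⊂L

  M₁ : Matching R X
  M₁ = ih (p⊂q⇒∣p∣<∣q∣ X⊂L) λ Z Z⊆X → cond Z (X⊆L ∘ Z⊆X)

  cond₂ : HallCondition (λ x → R x ─ N) (L ─ X)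
  cond₂ Z Z⊆L─X = ℕ.+-cancelʳ-≤ ∣ X ∣ ∣ Z ∣ _ (begin
    ∣ Z ∣ + ∣ X ∣                           ≤⟨ ℕ.+-monoˡ-≤ ∣ X ∣ (p⊆q⇒∣p∣≤∣q∣ Z⊆Z─X) ⟩
    ∣ Z ─ X ∣ + ∣ X ∣                       ≡⟨ ∣p∪q∣≡∣p─q∣+∣q∣ Z X ⟨
    ∣ Z ∪ X ∣                               ≤⟨ cond (Z ∪ X) Z∪X⊆L ⟩
    ∣ image R (Z ∪ X) ∣                     ≤⟨ p⊆q⇒∣p∣≤∣q∣ (image-∪ R Z X) ⟩
    ∣ image R Z ∪ N ∣                       ≡⟨ ∣p∪q∣≡∣p─q∣+∣q∣ (image R Z) N ⟩
    ∣ image R Z ─ N ∣ + ∣ N ∣               ≤⟨ ℕ.+-mono-≤ (p⊆q⇒∣p∣≤∣q∣ (image-─ R Z N)) ∣NX∣≤∣X∣ ⟩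
    ∣ image (λ x → R x ─ N) Z ∣ + ∣ X ∣     ∎)
    where
    open ℕ.≤-Reasoning
    Z⊆Z─X : Z ⊆ Z ─ X
    Z⊆Z─X z∈Z = x∈p∧x∉q⇒x∈p─q z∈Z (x∈p─q⇒x∉q (Z⊆L─X z∈Z))
    Z∪X⊆L : Z ∪ X ⊆ L
    Z∪X⊆L z∈Z∪X with x∈p∪q⁻ Z X z∈Z∪X
    ... | inj₁ z∈Z = p─q⊆p L X (Z⊆L─X z∈Z)
    ... | inj₂ z∈X = X⊆L z∈X

  M₂ : Matching (λ x → R x ─ N) (L ─ X)
  M₂ = ih (p∩q≢∅⇒∣p─q∣<∣p∣ L X (x , x∈p∩q⁺ (X⊆L x∈X , x∈X))) cond₂

hall-loose : ∀ {a b} {R : Fin a → Subset b} {L x₀} → HallBelow a b ∣ L ∣ →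
             HallCondition R L → x₀ ∈ L → (∀ X → ¬ Tight R L X) → Matching R L
hall-loose {b = b} {R = R} {L} {x₀} ih cond x₀∈L loose =
  combineMatchings ⁅ y ⁆ (singletonMatching y∈Rx₀) (λ _ → x∈⁅x⁆ y) M₂
  where
  x₀-hasNeighbour : Nonempty (image R ⁅ x₀ ⁆)
  x₀-hasNeighbour = 0<∣p∣⇒Nonempty (subst (_≤ ∣ image R ⁅ x₀ ⁆ ∣) (∣⁅x⁆∣≡1 x₀) (cond ⁅ x₀ ⁆ λ x∈⁅x₀⁆ →
    subst (_∈ L) (≡.sym (x∈⁅y⁆⇒x≡y x₀ x∈⁅x₀⁆)) x₀∈L))

  y : Fin b
  y = proj₁ x₀-hasNeighbour

  y∈Rx₀ : y ∈ R x₀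
  y∈Rx₀ with ∈-image⁻ R ⁅ x₀ ⁆ (proj₂ x₀-hasNeighbour)
  ... | x , x∈⁅x₀⁆ , y∈Rx = subst (λ x → y ∈ R x) (x∈⁅y⁆⇒x≡y x₀ x∈⁅x₀⁆) y∈Rx

  cond₂ : HallCondition (λ x → R x - y) (L - x₀)
  cond₂ Z Z⊆L-x₀ with nonempty? Z
  ... | no Z≡∅ = ℕ.≤-trans (ℕ.≤-reflexive (Empty⇒∣p∣≡0 Z≡∅)) z≤n
  ... | yes Z≢∅ = ℕ.+-cancelʳ-≤ 1 ∣ Z ∣ _ (begin
    ∣ Z ∣ + 1                           ≡⟨ ℕ.+-comm ∣ Z ∣ 1 ⟩
    suc ∣ Z ∣                           ≤⟨ ℕ.≰⇒> (λ ≤∣Z∣ → loose Z (Z≢∅ , Z⊂L , ≤∣Z∣)) ⟩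
    ∣ image R Z ∣                       ≤⟨ ∣p∣≤∣p∪q∣ (image R Z) ⁅ y ⁆ ⟩
    ∣ image R Z ∪ ⁅ y ⁆ ∣               ≡⟨ ∣p∪q∣≡∣p─q∣+∣q∣ (image R Z) ⁅ y ⁆ ⟩
    ∣ image R Z - y ∣ + ∣ ⁅ y ⁆ ∣       ≤⟨ ℕ.+-mono-≤ (p⊆q⇒∣p∣≤∣q∣ (image-─ R Z ⁅ y ⁆))
                                                      (ℕ.≤-reflexive (∣⁅x⁆∣≡1 y)) ⟩
    ∣ image (λ x → R x - y) Z ∣ + 1     ∎)
    where
    open ℕ.≤-Reasoning
    Z⊂L : Z ⊂ L
    Z⊂L = p─q⊆p L ⁅ x₀ ⁆ ∘ Z⊆L-x₀ , x₀ , x₀∈L , λ x₀∈Z → x∈p─q⇒x∉q (Z⊆L-x₀ x₀∈Z) (x∈⁅x⁆ x₀)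

  M₂ : Matching (λ x → R x - y) (L - x₀)
  M₂ = ih (x∈p⇒∣p-x∣<∣p∣ x₀∈L) cond₂

-- Halmos–Vaughan: split L along a tight set if there is one, otherwise match
-- any x₀ ∈ L to any of its neighbours and remove both.
hall-acc : ∀ (R : Fin a → Subset b) L → Acc _<_ ∣ L ∣ → HallCondition R L → Matching R L
hall-acc R L (acc rec) cond with nonempty? L | anySubset? (tight? R L)
... | no L≡∅         | _              = Empty⇒Matching L≡∅
... | yes (_ , x₀∈L) | yes (_ , tight) = hall-tight (λ lt → hall-acc _ _ (rec lt)) cond tight
... | yes (_ , x₀∈L) | no ¬tight      =
  hall-loose (λ lt → hall-acc _ _ (rec lt)) cond x₀∈L (λ X → ¬tight ∘ (X ,_))

hall : ∀ (R : Fin a → Subset b) L → HallCondition R L → Matching R L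
hall R L = hall-acc R L (<-wellFounded ∣ L ∣)

half : ℕ → ℚ
half k = ℤ.+ k ℚ./ 2

private
  halfᵘ : ℕ → ℚᵘ.ℚᵘ
  halfᵘ k = ℚᵘ.mkℚᵘ (ℤ.+ k) 1

  halfᵘ-+ : ∀ m n → halfᵘ (m + n) ℚᵘ.≃ halfᵘ m ℚᵘ.+ halfᵘ n
  halfᵘ-+ m n = ℚᵘ.*≡* (identity (ℤ.+ m) (ℤ.+ n))
    where
    identity : ∀ x y → (x ℤ.+ y) ℤ.* (ℤ.+ 2 ℤ.* ℤ.+ 2) ≡ (x ℤ.* ℤ.+ 2 ℤ.+ y ℤ.* ℤ.+ 2) ℤ.* ℤ.+ 2
    identity = ℤ-Solver.solve-∀

half-+ : ∀ m n → half (m + n) ≡ half m ℚ.+ half n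
half-+ m n = ℚ.toℚᵘ-injective (begin
  toℚᵘ (half (m + n))                    ≈⟨ ℚ.toℚᵘ-fromℚᵘ (halfᵘ (m + n)) ⟩
  halfᵘ (m + n)                          ≈⟨ halfᵘ-+ m n ⟩
  halfᵘ m ℚᵘ.+ halfᵘ n                   ≈⟨ ℚᵘ.+-cong (ℚ.toℚᵘ-fromℚᵘ (halfᵘ m))
                                                        (ℚ.toℚᵘ-fromℚᵘ (halfᵘ n)) ⟨
  toℚᵘ (half m) ℚᵘ.+ toℚᵘ (half n)       ≈⟨ ℚ.toℚᵘ-homo-+ (half m) (half n) ⟨
  toℚᵘ (half m ℚ.+ half n)               ∎)
  where open ℚᵘ.≃-Reasoning

half-mono-≤ : ∀ {m n} → m ≤ n → half m ℚ.≤ half n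
half-mono-≤ {m} {n} m≤n = ℚ.toℚᵘ-cancel-≤ (begin
  toℚᵘ (half m)  ≃⟨ ℚ.toℚᵘ-fromℚᵘ (halfᵘ m) ⟩
  halfᵘ m        ≤⟨ ℚᵘ.*≤* (ℤ.*-monoʳ-≤-nonNeg (ℤ.+ 2) (ℤ.+≤+ m≤n)) ⟩
  halfᵘ n        ≃⟨ ℚ.toℚᵘ-fromℚᵘ (halfᵘ n) ⟨
  toℚᵘ (half n)  ∎)
  where open ℚᵘ.≤-Reasoning

Σ-half : ∀ (f : Fin k → ℕ) → Σ (half ∘ f) ≡ half (sum f)
Σ-half {zero} f = refl
Σ-half {suc k} f = trans (cong (half (f zero) ℚ.+_) (Σ-half (f ∘ suc))) (≡.sym (half-+ (f zero) _))

half-value : ∀ {k} → k ≤ 2 → HalfValue (half k)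
half-value {0} _ = inj₁ refl
half-value {1} _ = inj₂ (inj₁ refl)
half-value {2} _ = inj₂ (inj₂ refl)
half-value {suc (suc (suc k))} (s≤s (s≤s ()))

half≡½⇒≡1 : ∀ {k} → k ≤ 2 → half k ≡ ½ → k ≡ 1
half≡½⇒≡1 {0} _ ()
half≡½⇒≡1 {1} _ _ = refl
half≡½⇒≡1 {2} _ ()
half≡½⇒≡1 {suc (suc (suc k))} (s≤s (s≤s ()))

neighbours : (G : Graph) → Fin (n G) → Subset (n G)
neighbours G v = tabulate (adj G v)

module _ (G : Graph) where

  Edge-sym : ∀ {v w} → Edge G v w → Edge G w v
  Edge-sym {v} {w} = subst T (Graph.sym G v w)

  Edge⇒∈neighbours : ∀ {v w} → Edge G v w → w ∈ neighbours G v
  Edge⇒∈neighbours e = ∈-tabulate⁺ (Equivalence.to T-≡ e)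

  ∈neighbours⇒Edge : ∀ {v w} → w ∈ neighbours G v → Edge G v w
  ∈neighbours⇒Edge w∈ = Equivalence.from T-≡ (∈-tabulate⁻ w∈)

CoversDoubleCover : (G : Graph) → Subset (n G) → Subset (n G) → Set
CoversDoubleCover G A B = ∀ v w → Edge G v w → v ∈ A ⊎ w ∈ B

colourClass-covers : ∀ (G : Graph) (c : Fin (n G) → Bool) → (∀ v w → Edge G v w → c v ≢ c w) →
                     CoversDoubleCover G (tabulate c) (tabulate c)
colourClass-covers G c proper v w e with c v in cv
... | true = inj₁ (∈-tabulate⁺ cv)
... | false = inj₂ (∈-tabulate⁺ (trans (¬-not (≢-sym (proper v w e))) (cong not cv)))

module _ (G : Graph) (uhc : UniquelyHalfCovered G) where

  doubledHalfCover≡1 : ∀ (h : Fin (n G) → ℕ) → (∀ v → h v ≤ 2) →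
                   (∀ v w → Edge G v w → 2 ≤ h v + h w) → sum h ≤ n G → ∀ v → h v ≡ 1
  doubledHalfCover≡1 h h≤2 h-edge ∑h≤n v =
    half≡½⇒≡1 (h≤2 v) (uhc (half ∘ h) cover (half-value ∘ h≤2) weight v)
    where
    cover : IsFractionalVertexCover G (half ∘ h)
    cover = (λ v → half-mono-≤ {0} {h v} z≤n , half-mono-≤ {h v} {2} (h≤2 v))
          , λ v w e → subst (1ℚ ℚ.≤_) (half-+ (h v) (h w))
                              (half-mono-≤ {2} {h v + h w} (h-edge v w e))
    weight : coverWeight G (half ∘ h) ℚ.≤ halfOrder G
    weight = subst (ℚ._≤ halfOrder G) (≡.sym (Σ-half h)) (half-mono-≤ {sum h} {n G} ∑h≤n)

  smallDoubleCover-partition : ∀ {A B} → CoversDoubleCover G A B → ∣ A ∣ + ∣ B ∣ ≤ n G →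
                  ∀ v → χ A v + χ B v ≡ 1
  smallDoubleCover-partition {A} {B} covers ∣A∣+∣B∣≤n =
    doubledHalfCover≡1 h (λ v → ℕ.+-mono-≤ (χ≤1 A v) (χ≤1 B v)) h-edge
      (subst (_≤ n G) (≡.sym sum-h) ∣A∣+∣B∣≤n)
    where
    h : Fin (n G) → ℕ
    h v = χ A v + χ B v
    sum-h : sum h ≡ ∣ A ∣ + ∣ B ∣
    sum-h = trans (∑-distrib-+ (χ A) (χ B)) (cong₂ _+_ (sum-χ A) (sum-χ B))
    shuffle : ∀ a b c d → (a + d) + (c + b) ≡ (a + b) + (c + d)
    shuffle = ℕ-Solver.solve-∀
    h-edge : ∀ v w → Edge G v w → 2 ≤ h v + h w
    h-edge v w e = ℕ.≤-trans (ℕ.+-mono-≤ (1≤χ+χ (covers v w e)) (1≤χ+χ (covers w v (Edge-sym G e))))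
                             (ℕ.≤-reflexive (shuffle (χ A v) (χ B v) (χ A w) (χ B w)))

  doubleCover-large : ∀ {A B} → CoversDoubleCover G A B → n G ≤ ∣ A ∣ + ∣ B ∣
  doubleCover-large {A} {B} covers with ∣ A ∣ + ∣ B ∣ ℕ.≤? n G
  ... | no ∣A∣+∣B∣≰n = ℕ.<⇒≤ (ℕ.≰⇒> ∣A∣+∣B∣≰n)
  ... | yes ∣A∣+∣B∣≤n = ℕ.≤-reflexive (begin
    n G                         ≡⟨ sum-const-1 (n G) ⟨
    sum {n G} (λ _ → 1)         ≡⟨ sum-cong-≗ (smallDoubleCover-partition covers ∣A∣+∣B∣≤n) ⟨
    sum (λ v → χ A v + χ B v)   ≡⟨ ∑-distrib-+ (χ A) (χ B) ⟩
    sum (χ A) + sum (χ B)       ≡⟨ cong₂ _+_ (sum-χ A) (sum-χ B) ⟩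
    ∣ A ∣ + ∣ B ∣               ∎)
    where open ≡.≡-Reasoning

  neighbours-hallCondition : HallCondition (neighbours G) ⊤
  neighbours-hallCondition X _ = ℕ.+-cancelʳ-≤ ∣ ∁ X ∣ ∣ X ∣ _ (begin
    ∣ X ∣ + ∣ ∁ X ∣                     ≡⟨ ∣p∣+∣∁p∣≡n X ⟩
    n G                                 ≤⟨ doubleCover-large covers ⟩
    ∣ ∁ X ∣ + ∣ image (neighbours G) X ∣ ≡⟨ ℕ.+-comm ∣ ∁ X ∣ _ ⟩
    ∣ image (neighbours G) X ∣ + ∣ ∁ X ∣ ∎)
    where
    open ℕ.≤-Reasoning
    covers : CoversDoubleCover G (∁ X) (image (neighbours G) X)
    covers v w e with v ∈? X
    ... | yes v∈X = inj₂ (∈-image⁺ v∈X (Edge⇒∈neighbours G e))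
    ... | no v∉X = inj₁ (x∉p⇒x∈∁p {p = X} v∉X)

  vertexCover-large : NonZero (n G) → ∀ {P} → CoversDoubleCover G P P → n G < ∣ P ∣ + ∣ P ∣
  vertexCover-large nz {P} covers =
    ℕ.≰⇒> λ small → m+m≢1 {χ P v} (smallDoubleCover-partition covers small v)
    where
    v : Fin (n G)
    v = fromℕ< (ℕ.>-nonZero⁻¹ (n G) {{nz}})
    m+m≢1 : ∀ {k} → k + k ≢ 1
    m+m≢1 {zero} ()
    m+m≢1 {suc zero} ()
    m+m≢1 {suc (suc k)} ()

  ¬bipartite : NonZero (n G) → ¬ IsBipartite G
  ¬bipartite nz (c , proper) = [ ¬P-small , ¬Q-small ]′ (ℕ.≤-total ∣ P ∣ ∣ Q ∣)
    where
    P Q : Subset (n G)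
    P = tabulate c
    Q = tabulate (not ∘ c)
    total : ∣ P ∣ + ∣ Q ∣ ≡ n G
    total = trans (cong (λ Q → ∣ P ∣ + ∣ Q ∣) (tabulate-∘ not c)) (∣p∣+∣∁p∣≡n P)
    ¬P-small : ¬ ∣ P ∣ ≤ ∣ Q ∣
    ¬P-small ∣P∣≤∣Q∣ = ℕ.<⇒≱ (vertexCover-large nz (colourClass-covers G c proper))
      (ℕ.≤-trans (ℕ.+-monoʳ-≤ ∣ P ∣ ∣P∣≤∣Q∣) (ℕ.≤-reflexive total))
    ¬Q-small : ¬ ∣ Q ∣ ≤ ∣ P ∣
    ¬Q-small ∣Q∣≤∣P∣ = ℕ.<⇒≱ (vertexCover-large nz (colourClass-covers G (not ∘ c) proper′))
      (ℕ.≤-trans (ℕ.+-monoˡ-≤ ∣ Q ∣ ∣Q∣≤∣P∣) (ℕ.≤-reflexive total))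
      where
      proper′ : ∀ v w → Edge G v w → not (c v) ≢ not (c w)
      proper′ v w e = proper v w e ∘ not-injective

module _ (G : Graph) where

  upper : (Fin (n G) → Fin (n G) → ℕ) → Fin (n G) → Fin (n G) → ℕ
  upper g v w = if adj G v w then (if toℕ v ℕ.<ᵇ toℕ w then g v w else 0) else 0

  onEdges : (Fin (n G) → Fin (n G) → ℕ) → Fin (n G) → Fin (n G) → ℕ
  onEdges g v w = if adj G v w then g v w else 0

  module _ {g : Fin (n G) → Fin (n G) → ℕ} (g-sym : ∀ v w → g v w ≡ g w v) where

    upper-+-upperᵀ : ∀ v w → upper g v w + upper g w v ≡ onEdges g v w
    upper-+-upperᵀ v w rewrite Graph.sym G w v with adj G v w in e
    ... | false = refl
    ... | true with toℕ v ℕ.<ᵇ toℕ w | ℕ.<ᵇ-reflects-< (toℕ v) (toℕ w)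
                  | toℕ w ℕ.<ᵇ toℕ v | ℕ.<ᵇ-reflects-< (toℕ w) (toℕ v)
    ...   | true  | ofʸ v<w | true  | ofʸ w<v = contradiction w<v (ℕ.<-asym v<w)
    ...   | true  | _       | false | _       = ℕ.+-identityʳ (g v w)
    ...   | false | _       | true  | _       = g-sym w v
    ...   | false | ofⁿ v≮w | false | ofⁿ w≮v =
      contradiction (trans (≡.sym (Graph.irrefl G v)) (subst (λ x → adj G v x ≡ true) (≡.sym v≡w) e))
                    λ ()
      where
      v≡w : v ≡ w
      v≡w = Fin.toℕ-injective (ℕ.≤-antisym (ℕ.≮⇒≥ w≮v) (ℕ.≮⇒≥ v≮w))

    sum-upper : 2 * sum (λ v → sum (upper g v)) ≡ sum (λ v → sum (onEdges g v))
    sum-upper = begin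
      2 * S
        ≡⟨ cong (S +_) (ℕ.+-identityʳ S) ⟩
      S + S
        ≡⟨ cong (S +_) (∑-comm (upper g)) ⟩
      S + sum (λ v → sum (λ w → upper g w v))
        ≡⟨ ∑-distrib-+ (λ v → sum (upper g v)) _ ⟨
      sum (λ v → sum (upper g v) + sum (λ w → upper g w v))
        ≡⟨ sum-cong-≗ (λ v → ∑-distrib-+ (upper g v) _) ⟨
      sum (λ v → sum (λ w → upper g v w + upper g w v))
        ≡⟨ sum-cong-≗ (λ v → sum-cong-≗ (upper-+-upperᵀ v)) ⟩
      sum (λ v → sum (onEdges g v))
        ∎
      where
      open ≡.≡-Reasoning
      S : ℕ
      S = sum (λ v → sum (upper g v))

module _ (G : Graph) (σ : Fin (n G) → Fin (n G)) (σ-edge : ∀ v → Edge G v (σ v))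
         (σ-injective : ∀ {v w} → σ v ≡ σ w → v ≡ w) where

  δ : Fin (n G) → Fin (n G) → ℕ
  δ v w = χ ⁅ σ v ⁆ w + χ ⁅ σ w ⁆ v

  matching : Fin (n G) → Fin (n G) → ℚ
  matching v w = half (δ v w)

  δ-sym : ∀ v w → δ v w ≡ δ w v
  δ-sym v w = ℕ.+-comm (χ ⁅ σ v ⁆ w) _

  δ≤2 : ∀ v w → δ v w ≤ 2
  δ≤2 v w = ℕ.+-mono-≤ (χ≤1 ⁅ σ v ⁆ w) (χ≤1 ⁅ σ w ⁆ v)

  onEdges-δ : ∀ v w → onEdges G δ v w ≡ δ v w
  onEdges-δ v w with adj G v w in e
  ... | true = refl
  ... | false = ≡.sym (cong₂ _+_ (χ-∉ (nonEdge e)) (χ-∉ (nonEdge (trans (Graph.sym G w v) e))))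
    where
    nonEdge : ∀ {v w} → adj G v w ≡ false → w ∉ ⁅ σ v ⁆
    nonEdge {v} e w∈⁅σv⁆ = subst T e (subst (Edge G v) (≡.sym (x∈⁅y⁆⇒x≡y (σ v) w∈⁅σv⁆)) (σ-edge v))

  row-sum : ∀ v → sum (λ w → χ ⁅ σ v ⁆ w) ≡ 1
  row-sum v = trans (sum-χ ⁅ σ v ⁆) (∣⁅x⁆∣≡1 (σ v))

  column-sum : ∀ v → sum (λ w → χ ⁅ σ w ⁆ v) ≤ 1
  column-sum v = sum≤1 _ (λ w → χ≤1 ⁅ σ w ⁆ v) λ w w′ p q → σ-injective (trans (≡.sym (v≡σ p)) (v≡σ q))
    where
    v≡σ : ∀ {w} → 0 < χ ⁅ σ w ⁆ v → v ≡ σ w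
    v≡σ {w} = x∈⁅y⁆⇒x≡y (σ w) ∘ 0<χ⇒∈

  sum-δ≤2 : ∀ v → sum (δ v) ≤ 2
  sum-δ≤2 v = begin
    sum (δ v)
      ≡⟨ ∑-distrib-+ (χ ⁅ σ v ⁆) _ ⟩
    sum (λ w → χ ⁅ σ v ⁆ w) + sum (λ w → χ ⁅ σ w ⁆ v)
      ≤⟨ ℕ.+-mono-≤ (ℕ.≤-reflexive (row-sum v)) (column-sum v) ⟩
    2
      ∎
    where open ℕ.≤-Reasoning

  sum-sum-δ : sum (λ v → sum (δ v)) ≡ 2 * n G
  sum-sum-δ = begin
    sum (λ v → sum (δ v))
      ≡⟨ sum-cong-≗ (λ v → ∑-distrib-+ (χ ⁅ σ v ⁆) _) ⟩
    sum (λ v → sum (λ w → χ ⁅ σ v ⁆ w) + sum (λ w → χ ⁅ σ w ⁆ v))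
      ≡⟨ ∑-distrib-+ (λ v → sum (χ ⁅ σ v ⁆)) _ ⟩
    R + sum (λ v → sum (λ w → χ ⁅ σ w ⁆ v))
      ≡⟨ cong (R +_) (∑-comm (λ v w → χ ⁅ σ w ⁆ v)) ⟩
    R + R
      ≡⟨ cong (R +_) (ℕ.+-identityʳ R) ⟨
    2 * R
      ≡⟨ cong (2 *_) (trans (sum-cong-≗ row-sum) (sum-const-1 (n G))) ⟩
    2 * n G
      ∎
    where
    open ≡.≡-Reasoning
    R : ℕ
    R = sum (λ v → sum (λ w → χ ⁅ σ v ⁆ w))

  matching-isFractionalMatching : IsFractionalMatching G matching
  matching-isFractionalMatching =
    (λ v w → cong half (δ-sym v w)) ,
    (λ v w _ → half-mono-≤ {0} {δ v w} z≤n , half-mono-≤ {δ v w} {2} (δ≤2 v w)) ,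
    load≤1
    where
    load≤1 : ∀ v → load G matching v ℚ.≤ 1ℚ
    load≤1 v = begin
      load G matching v              ≡⟨ Σ-cong (λ w → ≡.sym (if-float half (adj G v w))) ⟩
      Σ (half ∘ onEdges G δ v)       ≡⟨ Σ-half (onEdges G δ v) ⟩
      half (sum (onEdges G δ v))     ≡⟨ cong half (sum-cong-≗ (onEdges-δ v)) ⟩
      half (sum (δ v))               ≤⟨ half-mono-≤ {sum (δ v)} {2} (sum-δ≤2 v) ⟩
      half 2                         ∎
      where open ℚ.≤-Reasoning

  matching-halfIntegral : HalfIntegralMatching G matching
  matching-halfIntegral v w _ = half-value (δ≤2 v w)

  matching-isPerfect : IsPerfect G matching
  matching-isPerfect = begin
    matchingWeight G matching                   ≡⟨ Σ-cong (λ v → Σ-cong (half-upper v)) ⟩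
    Σ (λ v → Σ (half ∘ upper G δ v))            ≡⟨ Σ-cong (λ v → Σ-half (upper G δ v)) ⟩
    Σ (λ v → half (sum (upper G δ v)))          ≡⟨ Σ-half (λ v → sum (upper G δ v)) ⟩
    half S                                      ≡⟨ cong half (ℕ.*-cancelˡ-≡ S (n G) 2 twice) ⟩
    half (n G)                                  ∎
    where
    open ≡.≡-Reasoning
    half-upper : ∀ v w → (if adj G v w then (if toℕ v ℕ.<ᵇ toℕ w then matching v w else 0ℚ) else 0ℚ)
                         ≡ half (upper G δ v w)
    half-upper v w = ≡.sym (trans (if-float half (adj G v w))
                                  (if-cong-then (adj G v w) (if-float half (toℕ v ℕ.<ᵇ toℕ w))))
    S : ℕ
    S = sum (λ v → sum (upper G δ v))
    twice : 2 * S ≡ 2 * n G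
    twice = trans (sum-upper G δ-sym)
                  (trans (sum-cong-≗ (λ v → sum-cong-≗ (onEdges-δ v))) sum-sum-δ)

  halfIntegralPerfectMatching : ∃ λ (m : Fin (n G) → Fin (n G) → ℚ) →
    IsFractionalMatching G m × HalfIntegralMatching G m × IsPerfect G m
  halfIntegralPerfectMatching =
    matching , matching-isFractionalMatching , matching-halfIntegral , matching-isPerfect

neighbourInjection : ∀ (G : Graph) → UniquelyHalfCovered G →
  ∃ λ (σ : Fin (n G) → Fin (n G)) → (∀ v → Edge G v (σ v)) × (∀ {v w} → σ v ≡ σ w → v ≡ w)
neighbourInjection G uhc =
  (λ v → partner M (∈⊤ {x = v})) ,
  (λ v → ∈neighbours⇒Edge G (partner-∈ M (∈⊤ {x = v}))) ,
  partner-injective M ∈⊤ ∈⊤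
  where
  M : Matching (neighbours G) ⊤
  M = hall (neighbours G) ⊤ (neighbours-hallCondition G uhc)

lemma2p4 : (G : Graph) → NonZero (n G) → UniquelyHalfCovered G →
    ¬ IsBipartite G ×
    ∃ λ (m : Fin (n G) → Fin (n G) → ℚ) →
      IsFractionalMatching G m × HalfIntegralMatching G m × IsPerfect G m
lemma2p4 G nz uhc =
  let σ , σ-edge , σ-injective = neighbourInjection G uhc in
  ¬bipartite G uhc nz , halfIntegralPerfectMatching G σ σ-edge σ-injective
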